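{- Let $F:\mathbb{N}\to\mathbb{N}$ be a function and $b\geq 2$ an integer. Then: (1) if $n$ is a base $b$ $F$-Dudeney number, then $F(n)\geq b^{\frac{n-b+1}{b-1}}$; (2) if there is $N\in\mathbb{N}$ such that $n\geq N$ implies $F(n)<b^{\frac{n-b+1}{b-1}}$, then there are finitely many base $b$ $F$-Dudeney numbers.
   Context: For a non-negative integer $x=\sum_{i=0}^{m-1}a_ib^i$ written in base $b$ (digits $0\le a_i\le b-1$), $S_b(x)=\sum_{i=0}^{m-1}a_i$ is its base-$b$ digit sum. A natural number $n$ is a base $b$ $F$-Dudeney number if $n=S_b(F(n))$. -}

module Defs where

open import Data.Nat using (ℕ; zero; suc; _+_; _*_; _∸_; _^_; _≤_; _<_; NonZero)
open import Data.Nat.DivMod using (_/_; _%_)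
open import Data.Product using (_×_)
open import Relation.Binary.PropositionalEquality using (_≡_)

digitSumFuel : ℕ → (b : ℕ) → .{{NonZero b}} → ℕ → ℕ
digitSumFuel zero    b x = 0
digitSumFuel (suc k) b x = x % b + digitSumFuel k b (x / b)

-- S_b(x): the base-b digit sum of x.  Fuel x suffices for b ≥ 2 since x has
-- at most x base-b digits.
S : (b : ℕ) → .{{NonZero b}} → ℕ → ℕ
S b x = digitSumFuel x b x

IsDudeney : (b : ℕ) → .{{NonZero b}} → (ℕ → ℕ) → ℕ → Set
IsDudeney b F n = (1 ≤ n) × (n ≡ S b (F n))

-- F(n) ≥ b^((n-b+1)/(b-1)) for b ≥ 2, cleared of the real exponent:
-- raising both (non-negative) sides to the power b-1 and multiplying by b^(b-1)
-- gives the equivalent  b^n ≤ (b·F(n))^(b-1).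
GeBound : (b m n : ℕ) → Set
GeBound b m n = b ^ n ≤ (b * m) ^ (b ∸ 1)

-- F(n) < b^((n-b+1)/(b-1)), likewise:  (b·F(n))^(b-1) < b^n.
LtBound : (b m n : ℕ) → Set
LtBound b m n = (b * m) ^ (b ∸ 1) < b ^ n

{-# OPTIONS --safe #-}
module Submission where

-- Each base-b digit is at most b − 1, so b^(digit) ≤ b^(b−1); and each further
-- digit of x multiplies x by at least b.  Hence b^(S_b x) ≤ (b·x)^(b−1) for
-- x ≥ 1, which at x = F(n) with S_b(F n) = n is part (1).  Under the
-- hypothesis of part (2) this inequality fails for every n ≥ N, so all
-- Dudeney numbers lie below N.

open import Defs
open import Data.Nat using (ℕ; zero; suc; _+_; _*_; _∸_; _^_; _≤_; _<_; NonZero; z≤n; s≤s; >-nonZero)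
open import Data.Nat.Properties
open import Data.Nat.DivMod using (_/_; _%_; m%n<n; m%n≤m; m/n*n≤m; 0/n≡0)
open import Data.Nat.Solver using (module +-*-Solver)
open import Data.Product using (_×_; ∃-syntax; _,_)
open import Relation.Binary.PropositionalEquality
open import Relation.Nullary using (contradiction)
open import Function.Base using (it)

^-distribʳ-* : ∀ m n k → (m * n) ^ k ≡ m ^ k * n ^ k
^-distribʳ-* m n zero    = refl
^-distribʳ-* m n (suc k) = begin
  m * n * (m * n) ^ k     ≡⟨ cong (m * n *_) (^-distribʳ-* m n k) ⟩
  m * n * (m ^ k * n ^ k) ≡⟨ solve 4 (λ m n p q → m :* n :* (p :* q) := m :* p :* (n :* q)) refl m n (m ^ k) (n ^ k) ⟩
  m * m ^ k * (n * n ^ k) ∎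
  where
  open ≡-Reasoning
  open +-*-Solver

module _ (b : ℕ) .{{_ : NonZero b}} where

  digitSumFuel-zero : ∀ k → digitSumFuel k b 0 ≡ 0
  digitSumFuel-zero zero    = refl
  digitSumFuel-zero (suc k) = begin
    0 % b + digitSumFuel k b (0 / b) ≡⟨ cong₂ _+_ (n≤0⇒n≡0 (m%n≤m 0 b)) (cong (digitSumFuel k b) (0/n≡0 b)) ⟩
    0 + digitSumFuel k b 0           ≡⟨ digitSumFuel-zero k ⟩
    0                                ∎
    where open ≡-Reasoning

  b^digit≤b^[b∸1] : ∀ x → b ^ (x % b) ≤ b ^ (b ∸ 1)
  b^digit≤b^[b∸1] x = ^-monoʳ-≤ b (<⇒≤pred (m%n<n x b))

  b*[x/b]≤x : ∀ x → b * (x / b) ≤ x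
  b*[x/b]≤x x = ≤-trans (≤-reflexive (*-comm b (x / b))) (m/n*n≤m x b)

  b^digitSumFuel≤[b*x]^[b∸1] : ∀ k x → 1 ≤ x → b ^ digitSumFuel k b x ≤ (b * x) ^ (b ∸ 1)
  b^digitSumFuel≤[b*x]^[b∸1] zero x 1≤x = m^n>0 (b * x) {{m*n≢0 b x {{it}} {{>-nonZero 1≤x}}}} (b ∸ 1)
  b^digitSumFuel≤[b*x]^[b∸1] (suc k) x 1≤x with x / b in x/b≡q
  ... | zero = begin
    b ^ (x % b + digitSumFuel k b 0) ≡⟨ cong (λ s → b ^ (x % b + s)) (digitSumFuel-zero k) ⟩
    b ^ (x % b + 0)                  ≡⟨ cong (b ^_) (+-identityʳ (x % b)) ⟩
    b ^ (x % b)                      ≤⟨ b^digit≤b^[b∸1] x ⟩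
    b ^ (b ∸ 1)                      ≤⟨ ^-monoˡ-≤ (b ∸ 1) (m≤m*n b x {{>-nonZero 1≤x}}) ⟩
    (b * x) ^ (b ∸ 1)                ∎
    where open ≤-Reasoning
  ... | q@(suc _) = begin
    b ^ (x % b + digitSumFuel k b q)    ≡⟨ ^-distribˡ-+-* b (x % b) (digitSumFuel k b q) ⟩
    b ^ (x % b) * b ^ digitSumFuel k b q ≤⟨ *-mono-≤ (b^digit≤b^[b∸1] x) (b^digitSumFuel≤[b*x]^[b∸1] k q (s≤s z≤n)) ⟩
    b ^ (b ∸ 1) * (b * q) ^ (b ∸ 1)     ≡⟨ ^-distribʳ-* b (b * q) (b ∸ 1) ⟨
    (b * (b * q)) ^ (b ∸ 1)             ≤⟨ ^-monoˡ-≤ (b ∸ 1) (*-monoʳ-≤ b (subst (λ q → b * q ≤ x) x/b≡q (b*[x/b]≤x x))) ⟩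
    (b * x) ^ (b ∸ 1)                   ∎
    where open ≤-Reasoning

  b^S≤[b*x]^[b∸1] : ∀ x → 1 ≤ x → b ^ S b x ≤ (b * x) ^ (b ∸ 1)
  b^S≤[b*x]^[b∸1] x = b^digitSumFuel≤[b*x]^[b∸1] x x

  Dudeney⇒GeBound : ∀ F n → IsDudeney b F n → GeBound b (F n) n
  Dudeney⇒GeBound F n (1≤n , n≡S[Fn]) with F n
  ... | zero  = contradiction (≤-trans 1≤n (≤-reflexive n≡S[Fn])) λ ()
  ... | suc m = subst (λ s → b ^ s ≤ (b * suc m) ^ (b ∸ 1)) (sym n≡S[Fn]) (b^S≤[b*x]^[b∸1] (suc m) (s≤s z≤n))

  Dudeney-bounded : ∀ F N → (∀ n → N ≤ n → LtBound b (F n) n) → ∀ n → IsDudeney b F n → n < N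
  Dudeney-bounded F N lt n dn = ≰⇒> λ N≤n → <⇒≱ (lt n N≤n) (Dudeney⇒GeBound F n dn)

theorem5p2 : (F : ℕ → ℕ) (b : ℕ) .{{_ : NonZero b}} → 2 ≤ b →
    ((n : ℕ) → IsDudeney b F n → GeBound b (F n) n) ×
    ((∃[ N ] ((n : ℕ) → N ≤ n → LtBound b (F n) n)) →
      ∃[ M ] ((n : ℕ) → IsDudeney b F n → n < M))
-- The bound holds for every b ≥ 1.
theorem5p2 F b _ = Dudeney⇒GeBound b F , λ (N , lt) → N , Dudeney-bounded b F N lt
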